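{- Let $M=(\mathbb{F}_2^n,m)$ be a Boolean multiset and let $C(M)$ be its constant set. Then $B(M)$ is a disjoint union of affine subspaces of $\mathbb{F}_2^n$, each having $C(M)$ as its underlying vector space.
   Context: For $\mathbf{x},\mathbf{y}\in\mathbb{F}_2^n$ the pairing is $\mathbf{x}\cdot\mathbf{y}=\sum_{i=1}^n x_iy_i\in\mathbb{F}_2$. A Boolean multiset is a pair $M=(\mathbb{F}_2^n,m)$ with $m:\mathbb{F}_2^n\to\mathbb{Z}_{\geq 0}$; its support is $S_M=\{\mathbf{x}\mid m(\mathbf{x})>0\}$. A vector $\mathbf{y}\in\mathbb{F}_2^n$ balances $M$ if $\sum_{\mathbf{x}\in S_M}m(\mathbf{x})(-1)^{\mathbf{x}\cdot\mathbf{y}}=0$, and fixes $M$ if $\left|\sum_{\mathbf{x}\in S_M}m(\mathbf{x})(-1)^{\mathbf{x}\cdot\mathbf{y}}\right|=\sum_{\mathbf{x}\in S_M}m(\mathbf{x})$. $B(M)$ is the set of vectors balancing $M$ and the constant set $C(M)$ is the set of vectors fixing $M$. -}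

module Defs where

open import Data.Bool using (Bool; true; false; _xor_; _∧_)
open import Data.Nat using (ℕ; zero; suc; _<?_)
import Data.Nat as ℕ
open import Data.Integer using (ℤ; +_; -_; ∣_∣)
import Data.Integer as ℤ
open import Data.Vec using (Vec; []; _∷_; zipWith; replicate)
open import Data.List using (List; []; _∷_; map; _++_; filter; foldr)
open import Data.Fin using (Fin)
open import Data.Product using (Σ; ∃; _×_; _,_)
open import Relation.Binary.PropositionalEquality using (_≡_; _≢_)
open import Relation.Nullary using (¬_)
open import Function.Bundles using (_⇔_)
open import Level using (0ℓ)

-- F₂ⁿ : vectors of booleans (false = 0, true = 1); addition = xor
F₂ⁿ : ℕ → Set
F₂ⁿ n = Vec Bool n

_⊕_ : ∀ {n} → F₂ⁿ n → F₂ⁿ n → F₂ⁿ n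
_⊕_ = zipWith _xor_

𝟎 : ∀ {n} → F₂ⁿ n
𝟎 = replicate _ false

_·_ : ∀ {n} → F₂ⁿ n → F₂ⁿ n → Bool
[] · [] = false
(a ∷ x) · (b ∷ y) = (a ∧ b) xor (x · y)

allVecs : (n : ℕ) → List (F₂ⁿ n)
allVecs zero = [] ∷ []
allVecs (suc n) = map (false ∷_) (allVecs n) ++ map (true ∷_) (allVecs n)

Multiset : ℕ → Set
Multiset n = F₂ⁿ n → ℕ

support : ∀ {n} → Multiset n → List (F₂ⁿ n)
support {n} m = filter (λ x → 0 <? m x) (allVecs n)

sgn : Bool → ℤ
sgn false = + 1
sgn true  = - (+ 1)

charSum : ∀ {n} → Multiset n → F₂ⁿ n → ℤ
charSum m y = foldr (λ x acc → (+ m x) ℤ.* sgn (x · y) ℤ.+ acc) (+ 0) (support m)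

total : ∀ {n} → Multiset n → ℕ
total m = foldr (λ x acc → m x ℕ.+ acc) 0 (support m)

Subset : ℕ → Set₁
Subset n = F₂ⁿ n → Set

B : ∀ {n} → Multiset n → Subset n
B m y = charSum m y ≡ + 0

C : ∀ {n} → Multiset n → Subset n
C m y = ∣ charSum m y ∣ ≡ total m

-- linear subspace of F₂ⁿ (scalars are 0,1: contains 0 and closed under +)
IsSubspace : ∀ {n} → Subset n → Set
IsSubspace {n} V = V 𝟎 × (∀ (u v : F₂ⁿ n) → V u → V v → V (u ⊕ v))

IsAffineWith : ∀ {n} → Subset n → Subset n → Set
IsAffineWith {n} A V = IsSubspace V × Σ (F₂ⁿ n) (λ a → ∀ x → A x ⇔ V (x ⊕ a))

IsDisjointUnionOfAffine : ∀ {n} → Subset n → Subset n → Set₁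
IsDisjointUnionOfAffine {n} S V =
  Σ ℕ λ k → Σ (Fin k → Subset n) λ A →
      (∀ i → IsAffineWith (A i) V)
    × (∀ i j → i ≢ j → ∀ x → ¬ (A i x × A j x))
    × (∀ x → S x ⇔ ∃ λ i → A i x)

-- y fixes M exactly when x · y is constant on the support: writing the character sum as P − N
-- with total P + N, the equation |P − N| = P + N forces P = 0 or N = 0.  Hence C(M) is a
-- subspace, and translating y by c ∈ C(M) multiplies the character sum by ±1, so B(M) is a
-- union of cosets of C(M); deduplicating B(M) modulo C(M) leaves one representative per coset.
module Submission where

open import Defs
open import Algebra.Bundles using (CommutativeRing)
open import Data.Bool using (Bool; true; false; _xor_; _∧_; if_then_else_)
open import Data.Bool.Properties
  using (xor-assoc; xor-comm; xor-same; xor-identityˡ; ∧-zeroʳ; ∧-distribˡ-xor; xor-∧-commutativeRing)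
open import Data.Nat using (ℕ; zero; suc; _<_; _≤_; s≤s; _<?_)
import Data.Nat as ℕ
import Data.Nat.Properties as ℕₚ
open import Algebra.Properties.CommutativeSemigroup ℕₚ.+-commutativeSemigroup
  using () renaming (x∙yz≈y∙xz to x+[y+z]≡y+[x+z])
open import Algebra.Properties.CommutativeSemigroup (CommutativeRing.+-commutativeSemigroup xor-∧-commutativeRing)
  using () renaming (interchange to xor-interchange)
open import Data.Integer using (ℤ; +_; -_; ∣_∣; _⊖_)
import Data.Integer as ℤ
import Data.Integer.Properties as ℤₚ
open import Data.Vec using ([]; _∷_)
open import Data.Vec.Properties using (zipWith-comm; zipWith-assoc; zipWith-identityˡ)
open import Data.List using (List; []; _∷_; map; filter; foldr; length; lookup; deduplicate)
open import Data.List.Relation.Unary.All as All using (All; []; _∷_)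
open import Data.List.Relation.Unary.AllPairs using (_∷_)
import Data.List.Relation.Unary.All.Properties as Allₚ
open import Data.List.Relation.Unary.Any as Any using (Any; here)
import Data.List.Relation.Unary.Any.Properties as Anyₚ
open import Data.List.Membership.Propositional using (_∈_)
open import Data.List.Membership.Propositional.Properties using (∈-++⁺ˡ; ∈-++⁺ʳ; ∈-map⁺; ∈-filter⁺; ∈-lookup)
import Data.List.Relation.Unary.Unique.Setoid as UniqueSetoid
open import Data.List.Relation.Unary.Unique.DecSetoid.Properties using (deduplicate-!)
open import Data.Fin using (Fin; zero; suc)
open import Data.Product using (∃; _×_; _,_; proj₁; proj₂)
open import Data.Sum using (_⊎_; inj₁; inj₂)
open import Data.Empty using (⊥-elim)
open import Function.Base using (id)
open import Function.Bundles using (_⇔_; mk⇔)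
open import Level using (0ℓ)
open import Relation.Binary.Bundles using (Setoid; DecSetoid)
open import Relation.Nullary using (¬_)
open import Relation.Unary using (Decidable)
open import Relation.Binary.PropositionalEquality
  using (_≡_; _≢_; refl; sym; trans; cong; cong₂; subst; module ≡-Reasoning)

module _ {A : Set} where

  -- charSum m y and total m are, definitionally, signedSum m (_· y) (support m) and weight m (support m).
  weight : (A → ℕ) → List A → ℕ
  weight w = foldr (λ x acc → w x ℕ.+ acc) 0

  signedSum : (A → ℕ) → (A → Bool) → List A → ℤ
  signedSum w ε = foldr (λ x acc → + w x ℤ.* sgn (ε x) ℤ.+ acc) (+ 0)

  ConstantOn : List A → (A → Bool) → Set
  ConstantOn xs ε = ∃ λ b → All (λ x → ε x ≡ b) xs

  positiveWeight negativeWeight : (A → ℕ) → (A → Bool) → List A → ℕ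
  positiveWeight w ε = weight (λ x → if ε x then 0 else w x)
  negativeWeight w ε = weight (λ x → if ε x then w x else 0)

-m+[n⊖o]≡n⊖[m+o] : ∀ m n o → - (+ m) ℤ.+ (n ⊖ o) ≡ n ⊖ (m ℕ.+ o)
-m+[n⊖o]≡n⊖[m+o] zero    n o = ℤₚ.+-identityˡ (n ⊖ o)
-m+[n⊖o]≡n⊖[m+o] (suc m) n o = ℤₚ.distribʳ-⊖-+-neg m n o

∣m⊖n∣≡m+n⇒m≡0⊎n≡0 : ∀ m n → ∣ m ⊖ n ∣ ≡ m ℕ.+ n → m ≡ 0 ⊎ n ≡ 0
∣m⊖n∣≡m+n⇒m≡0⊎n≡0 zero    n       _  = inj₁ refl
∣m⊖n∣≡m+n⇒m≡0⊎n≡0 (suc m) zero    _  = inj₂ refl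
∣m⊖n∣≡m+n⇒m≡0⊎n≡0 (suc m) (suc n) eq = ⊥-elim (ℕₚ.<⇒≱ m+n<∣m⊖n∣ ∣m⊖n∣≤m+n)
  where
  ∣m⊖n∣≤m+n : ∣ m ⊖ n ∣ ≤ m ℕ.+ n
  ∣m⊖n∣≤m+n = ℕₚ.≤-trans (ℤₚ.∣m⊝n∣≤m⊔n m n) (ℕₚ.m⊔n≤m+n m n)
  m+n<∣m⊖n∣ : m ℕ.+ n < ∣ m ⊖ n ∣
  m+n<∣m⊖n∣ = subst (m ℕ.+ n <_) (trans (sym eq) (cong ∣_∣ (ℤₚ.[1+m]⊖[1+n]≡m⊖n m n)))
    (ℕₚ.<-≤-trans (ℕₚ.n<1+n _) (s≤s (ℕₚ.+-monoʳ-≤ m (ℕₚ.n≤1+n n))))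

sgn-xor : ∀ a b → sgn (a xor b) ≡ sgn a ℤ.* sgn b
sgn-xor false false = refl
sgn-xor false true  = refl
sgn-xor true  false = refl
sgn-xor true  true  = refl

∣sgn∣≡1 : ∀ b → ∣ sgn b ∣ ≡ 1
∣sgn∣≡1 false = refl
∣sgn∣≡1 true  = refl

if-then-0-else≡0⇒true : ∀ b {k} → 0 < k → (if b then 0 else k) ≡ 0 → b ≡ true
if-then-0-else≡0⇒true true  _   _  = refl
if-then-0-else≡0⇒true false 0<k eq = ⊥-elim (ℕₚ.<-irrefl (sym eq) 0<k)

if-then-else-0≡0⇒false : ∀ b {k} → 0 < k → (if b then k else 0) ≡ 0 → b ≡ false
if-then-else-0≡0⇒false false _   _  = refl
if-then-else-0≡0⇒false true  0<k eq = ⊥-elim (ℕₚ.<-irrefl (sym eq) 0<k)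

weight≡0⇒All≡0 : ∀ {A : Set} (w : A → ℕ) xs → weight w xs ≡ 0 → All (λ x → w x ≡ 0) xs
weight≡0⇒All≡0 w []       _  = []
weight≡0⇒All≡0 w (x ∷ xs) eq =
  ℕₚ.m+n≡0⇒m≡0 (w x) eq ∷ weight≡0⇒All≡0 w xs (ℕₚ.m+n≡0⇒n≡0 (w x) eq)

module _ {A : Set} (w : A → ℕ) (ε : A → Bool) where

  private
    P N : List A → ℕ
    P = positiveWeight w ε
    N = negativeWeight w ε

  signedSum≡positive⊖negative : ∀ xs →
                                signedSum w ε xs ≡ positiveWeight w ε xs ⊖ negativeWeight w ε xs
  signedSum≡positive⊖negative []       = refl
  signedSum≡positive⊖negative (x ∷ xs) with ε x
  ... | false = trans (cong₂ ℤ._+_ (ℤₚ.*-identityʳ (+ w x)) (signedSum≡positive⊖negative xs))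
                      (ℤₚ.distribʳ-⊖-+-pos (w x) (P xs) (N xs))
  ... | true  = trans (cong₂ ℤ._+_ (ℤₚ.*-comm (+ w x) (- + 1)) (signedSum≡positive⊖negative xs))
                      (trans (cong (ℤ._+ (P xs ⊖ N xs)) (ℤₚ.-1*i≡-i (+ w x)))
                             (-m+[n⊖o]≡n⊖[m+o] (w x) (P xs) (N xs)))

  weight≡positive+negative : ∀ xs → weight w xs ≡ positiveWeight w ε xs ℕ.+ negativeWeight w ε xs
  weight≡positive+negative []       = refl
  weight≡positive+negative (x ∷ xs) with ε x
  ... | false = trans (cong (w x ℕ.+_) (weight≡positive+negative xs))
                      (sym (ℕₚ.+-assoc (w x) (P xs) (N xs)))
  ... | true  = trans (cong (w x ℕ.+_) (weight≡positive+negative xs))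
                      (x+[y+z]≡y+[x+z] (w x) (P xs) (N xs))

  ∣signedSum∣≡weight⇒constant : ∀ xs → All (λ x → 0 < w x) xs →
                                 ∣ signedSum w ε xs ∣ ≡ weight w xs → ConstantOn xs ε
  ∣signedSum∣≡weight⇒constant xs 0<w eq = constant (∣m⊖n∣≡m+n⇒m≡0⊎n≡0 (P xs) (N xs) ∣P⊖N∣≡P+N)
    where
    ∣P⊖N∣≡P+N : ∣ P xs ⊖ N xs ∣ ≡ P xs ℕ.+ N xs
    ∣P⊖N∣≡P+N = begin
      ∣ P xs ⊖ N xs ∣          ≡⟨ cong ∣_∣ (signedSum≡positive⊖negative xs) ⟨
      ∣ signedSum w ε xs ∣     ≡⟨ eq ⟩
      weight w xs             ≡⟨ weight≡positive+negative xs ⟩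
      P xs ℕ.+ N xs           ∎
      where open ≡-Reasoning
    constant : P xs ≡ 0 ⊎ N xs ≡ 0 → ConstantOn xs ε
    constant (inj₁ P≡0) = true , All.zipWith (λ {x} (0<wx , z) → if-then-0-else≡0⇒true (ε x) 0<wx z)
                                             (0<w , weight≡0⇒All≡0 _ xs P≡0)
    constant (inj₂ N≡0) = false , All.zipWith (λ {x} (0<wx , z) → if-then-else-0≡0⇒false (ε x) 0<wx z)
                                              (0<w , weight≡0⇒All≡0 _ xs N≡0)

module _ {A : Set} (w : A → ℕ) where

  signedSum-false : ∀ xs → signedSum w (λ _ → false) xs ≡ + weight w xs
  signedSum-false []       = refl
  signedSum-false (x ∷ xs) = cong₂ ℤ._+_ (ℤₚ.*-identityʳ (+ w x)) (signedSum-false xs)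

  signedSum-xor : ∀ ε ε′ b xs → All (λ x → ε′ x ≡ ε x xor b) xs →
                  signedSum w ε′ xs ≡ signedSum w ε xs ℤ.* sgn b
  signedSum-xor ε ε′ b []       []       = refl
  signedSum-xor ε ε′ b (x ∷ xs) (e ∷ es) = begin
    + w x ℤ.* sgn (ε′ x) ℤ.+ signedSum w ε′ xs
      ≡⟨ cong₂ ℤ._+_ (cong (λ a → + w x ℤ.* sgn a) e) (signedSum-xor ε ε′ b xs es) ⟩
    + w x ℤ.* sgn (ε x xor b) ℤ.+ S ℤ.* sgn b
      ≡⟨ cong (λ t → + w x ℤ.* t ℤ.+ S ℤ.* sgn b) (sgn-xor (ε x) b) ⟩
    + w x ℤ.* (sgn (ε x) ℤ.* sgn b) ℤ.+ S ℤ.* sgn b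
      ≡⟨ cong (ℤ._+ S ℤ.* sgn b) (sym (ℤₚ.*-assoc (+ w x) (sgn (ε x)) (sgn b))) ⟩
    + w x ℤ.* sgn (ε x) ℤ.* sgn b ℤ.+ S ℤ.* sgn b
      ≡⟨ ℤₚ.*-distribʳ-+ (sgn b) (+ w x ℤ.* sgn (ε x)) S ⟨
    (+ w x ℤ.* sgn (ε x) ℤ.+ S) ℤ.* sgn b ∎
    where
    open ≡-Reasoning
    S : ℤ
    S = signedSum w ε xs

  constant⇒∣signedSum∣≡weight : ∀ ε xs → ConstantOn xs ε → ∣ signedSum w ε xs ∣ ≡ weight w xs
  constant⇒∣signedSum∣≡weight ε xs (b , ε≡b) = begin
    ∣ signedSum w ε xs ∣        ≡⟨ cong ∣_∣ (signedSum-xor (λ _ → false) ε b xs ε≡b) ⟩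
    ∣ S₀ ℤ.* sgn b ∣            ≡⟨ ℤₚ.∣i*j∣≡∣i∣*∣j∣ S₀ (sgn b) ⟩
    ∣ S₀ ∣ ℕ.* ∣ sgn b ∣         ≡⟨ cong₂ ℕ._*_ (cong ∣_∣ (signedSum-false xs)) (∣sgn∣≡1 b) ⟩
    weight w xs ℕ.* 1           ≡⟨ ℕₚ.*-identityʳ (weight w xs) ⟩
    weight w xs                 ∎
    where
    open ≡-Reasoning
    S₀ : ℤ
    S₀ = signedSum w (λ _ → false) xs

⊕-self : ∀ {n} (x : F₂ⁿ n) → x ⊕ x ≡ 𝟎
⊕-self []      = refl
⊕-self (a ∷ x) = cong₂ _∷_ (xor-same a) (⊕-self x)

module _ {n : ℕ} where

  ⊕-comm : (x y : F₂ⁿ n) → x ⊕ y ≡ y ⊕ x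
  ⊕-comm = zipWith-comm xor-comm

  ⊕-assoc : (x y z : F₂ⁿ n) → (x ⊕ y) ⊕ z ≡ x ⊕ (y ⊕ z)
  ⊕-assoc = zipWith-assoc xor-assoc

  ⊕-identityˡ : (x : F₂ⁿ n) → 𝟎 ⊕ x ≡ x
  ⊕-identityˡ = zipWith-identityˡ xor-identityˡ

  ⊕-cancelˡ : (x y : F₂ⁿ n) → x ⊕ (x ⊕ y) ≡ y
  ⊕-cancelˡ x y = begin
    x ⊕ (x ⊕ y) ≡⟨ ⊕-assoc x x y ⟨
    (x ⊕ x) ⊕ y ≡⟨ cong (_⊕ y) (⊕-self x) ⟩
    𝟎 ⊕ y       ≡⟨ ⊕-identityˡ y ⟩
    y           ∎
    where open ≡-Reasoning

  ⊕-cancel-middle : (x y z : F₂ⁿ n) → (x ⊕ y) ⊕ (y ⊕ z) ≡ x ⊕ z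
  ⊕-cancel-middle x y z = trans (⊕-assoc x y (y ⊕ z)) (cong (x ⊕_) (⊕-cancelˡ y z))

·-zeroʳ : ∀ {n} (x : F₂ⁿ n) → x · 𝟎 ≡ false
·-zeroʳ []      = refl
·-zeroʳ (a ∷ x) = cong₂ _xor_ (∧-zeroʳ a) (·-zeroʳ x)

·-distribˡ-⊕ : ∀ {n} (x y z : F₂ⁿ n) → x · (y ⊕ z) ≡ (x · y) xor (x · z)
·-distribˡ-⊕ []      []      []      = refl
·-distribˡ-⊕ (a ∷ x) (b ∷ y) (c ∷ z) =
  trans (cong₂ _xor_ (∧-distribˡ-xor a b c) (·-distribˡ-⊕ x y z))
        (xor-interchange (a ∧ b) (a ∧ c) (x · y) (x · z))

∈-allVecs : ∀ {n} (x : F₂ⁿ n) → x ∈ allVecs n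
∈-allVecs []                  = here refl
∈-allVecs {suc n} (false ∷ x) = ∈-++⁺ˡ (∈-map⁺ (false ∷_) (∈-allVecs x))
∈-allVecs {suc n} (true ∷ x)  = ∈-++⁺ʳ (map (false ∷_) (allVecs n)) (∈-map⁺ (true ∷_) (∈-allVecs x))

module _ {a ℓ} (S : Setoid a ℓ) where

  open Setoid S using (_≈_) renaming (sym to ≈-sym)
  open UniqueSetoid S using (Unique)

  Unique-lookup-injective : ∀ {xs} → Unique xs → ∀ i j → lookup xs i ≈ lookup xs j → i ≡ j
  Unique-lookup-injective (_    ∷ _) zero    zero    _  = refl
  Unique-lookup-injective (x≉xs ∷ _) zero    (suc j) eq = ⊥-elim (All.lookup x≉xs (∈-lookup j) eq)
  Unique-lookup-injective (x≉xs ∷ _) (suc i) zero    eq = ⊥-elim (All.lookup x≉xs (∈-lookup i) (≈-sym eq))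
  Unique-lookup-injective (_    ∷ u) (suc i) (suc j) eq = cong suc (Unique-lookup-injective u i j eq)

module _ {n : ℕ} {V : Subset n} (V-subspace : IsSubspace V) (V? : Decidable V) where

  private
    V𝟎 : V 𝟎
    V𝟎 = proj₁ V-subspace

    V-⊕ : ∀ u v → V u → V v → V (u ⊕ v)
    V-⊕ = proj₂ V-subspace

  cosetDecSetoid : DecSetoid 0ℓ 0ℓ
  cosetDecSetoid = record
    { Carrier          = F₂ⁿ n
    ; _≈_              = λ x y → V (x ⊕ y)
    ; isDecEquivalence = record
      { isEquivalence = record
        { refl  = λ {x} → subst V (sym (⊕-self x)) V𝟎
        ; sym   = λ {x} {y} → subst V (⊕-comm x y)
        ; trans = λ {x} {y} {z} p q → subst V (⊕-cancel-middle x y z) (V-⊕ _ _ p q)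
        }
      ; _≟_ = λ x y → V? (x ⊕ y)
      }
    }

  open DecSetoid cosetDecSetoid
    using (_≈_; _≟_; reflexive; setoid) renaming (sym to ≈-sym; trans to ≈-trans)
  open UniqueSetoid setoid using (Unique)

  isDisjointUnionOfCosets : {S : Subset n} → Decidable S → (∀ {y c} → S y → V c → S (y ⊕ c)) →
                            IsDisjointUnionOfAffine S V
  isDisjointUnionOfCosets {S} S? S-translate =
    length reps , coset , (λ i → V-subspace , lookup reps i , λ x → mk⇔ id id) , disjoint , covers
    where
    reps : List (F₂ⁿ n)
    reps = deduplicate _≟_ (filter S? (allVecs n))

    reps-unique : Unique reps
    reps-unique = deduplicate-! cosetDecSetoid (filter S? (allVecs n))

    coset : Fin (length reps) → Subset n
    coset i x = x ≈ lookup reps i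

    disjoint : ∀ i j → i ≢ j → ∀ x → ¬ (coset i x × coset j x)
    disjoint i j i≢j x (x≈rᵢ , x≈rⱼ) =
      i≢j (Unique-lookup-injective setoid reps-unique i j (≈-trans (≈-sym x≈rᵢ) x≈rⱼ))

    S-reps : All S reps
    S-reps = Allₚ.deduplicate⁺ _≟_ (Allₚ.all-filter S? (allVecs n))

    covers : ∀ x → S x ⇔ ∃ λ i → coset i x
    covers x = mk⇔ to from
      where
      to : S x → ∃ λ i → coset i x
      to Sx = Any.index x≈rep , Anyₚ.lookup-index x≈rep
        where
        x≈rep : Any (x ≈_) reps
        x≈rep = Anyₚ.deduplicate⁺ _≟_ (λ b≈a x≈a → ≈-trans x≈a (≈-sym b≈a))
                  (Any.map reflexive (∈-filter⁺ S? (∈-allVecs x) Sx))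
      from : (∃ λ i → coset i x) → S x
      from (i , x≈r) = subst S (⊕-cancelˡ r x) (S-translate Sr (≈-sym x≈r))
        where
        r : F₂ⁿ n
        r = lookup reps i
        Sr : S r
        Sr = All.lookup S-reps (∈-lookup i)

module _ {n : ℕ} (m : Multiset n) where

  fixes⇒constant : ∀ {y} → C m y → ConstantOn (support m) (_· y)
  fixes⇒constant {y} =
    ∣signedSum∣≡weight⇒constant m (_· y) (support m) (Allₚ.all-filter (λ x → 0 <? m x) (allVecs n))

  constant⇒fixes : ∀ {y} → ConstantOn (support m) (_· y) → C m y
  constant⇒fixes {y} = constant⇒∣signedSum∣≡weight m (_· y) (support m)

  C-isSubspace : IsSubspace (C m)
  C-isSubspace = constant⇒fixes (false , All.tabulate (λ {x} _ → ·-zeroʳ x)) , C-⊕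
    where
    C-⊕ : ∀ u v → C m u → C m v → C m (u ⊕ v)
    C-⊕ u v Cu Cv with fixes⇒constant Cu | fixes⇒constant Cv
    ... | b , u≡b | b′ , v≡b′ = constant⇒fixes (b xor b′ , All.zipWith
           (λ {x} (x·u≡b , x·v≡b′) → trans (·-distribˡ-⊕ x u v) (cong₂ _xor_ x·u≡b x·v≡b′)) (u≡b , v≡b′))

  balancing-translate : ∀ {y c} → B m y → C m c → B m (y ⊕ c)
  balancing-translate {y} {c} By Cc with fixes⇒constant Cc
  ... | b , c≡b = begin
    charSum m (y ⊕ c)      ≡⟨ signedSum-xor m (_· y) (_· (y ⊕ c)) b (support m) y⊕c≡y+b ⟩
    charSum m y ℤ.* sgn b  ≡⟨ cong (ℤ._* sgn b) By ⟩
    + 0                    ∎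
    where
    open ≡-Reasoning
    y⊕c≡y+b : All (λ x → x · (y ⊕ c) ≡ (x · y) xor b) (support m)
    y⊕c≡y+b = All.map (λ {x} x·c≡b → trans (·-distribˡ-⊕ x y c) (cong ((x · y) xor_) x·c≡b)) c≡b

  fixes? : Decidable (C m)
  fixes? y = ∣ charSum m y ∣ ℕ.≟ total m

  balances? : Decidable (B m)
  balances? y = charSum m y ℤ.≟ + 0

proposition11 : (n : ℕ) (m : Multiset n) → IsDisjointUnionOfAffine (B m) (C m)
proposition11 n m = isDisjointUnionOfCosets (C-isSubspace m) (fixes? m) (balances? m) (balancing-translate m)
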